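{- The locality gap of the algorithm $\mathcal{LS}$ for the MCBM problem is at least $\frac{13}{6}$: there exist an MCBM instance $G$ and a compatible matching $M$ of $G$ such that, if $M$ is used as the starting matching of $\mathcal{LS}$, the algorithm terminates without modifying $M$ (i.e., $M$ is a maximal compatible matching to which neither Replace-5-by-6 nor Reduce-5-by-5 applies), while a maximum compatible matching of $G$ has cardinality $\frac{13}{6}|M|$.
   Context: MCBM: Let $G=(D^A,D^B,E)$ be a bipartite graph with $D^A=\{d^A_1,\dots,d^A_{N}\}$, $D^B=\{d^B_1,\dots,d^B_{N}\}$; write $e_{i,j}$ for the edge between $d^A_i$ and $d^B_j$. Two distinct edges conflict if (i) they share an endpoint, or (ii) they are $e_{i,j}$ and $e_{i+1,j'}$ with $j'\neq j+1$, or (iii) they are $e_{i,j}$ and $e_{i',j+1}$ with $i'\ne i+1$; otherwise they are compatible. Edges $e_{i,j}$ and $e_{i+1,j+1}$ are parallel. A compatible matching is a set of pairwise compatible edges; MCBM asks for one of maximum cardinality. An edge of a compatible matching $M$ is a singleton if it is parallel to no other edge of $M$; $s(M)$ is the set of singletons. Local moves of $\mathcal{LS}$ on a maximal compatible matching $M$ (with $|M|>5$): for a $5$-element $X\subseteq M$, let $C(X)$ be the set of edges conflicting with some edge of $X$ and compatible with all of $M\setminus X$. Replace-5-by-6 replaces $X$ by a $6$-element pairwise compatible $X'\subseteq X\cup C(X)$; Reduce-5-by-5 replaces $X$ by a $5$-element pairwise compatible $X'\subseteq X\cup C(X)$ with $|s((M\setminus X)\cup X')|<|s(M)|$. (For $|M|\le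 5$ these are replaced by exhaustive search for a compatible matching of size $|M|+1$, respectively of size $|M|$ with fewer singletons.) $\mathcal{LS}$ repeatedly extends $M$ to a maximal compatible matching and applies Replace-5-by-6 if possible, otherwise Reduce-5-by-5 if possible, and otherwise terminates. The locality gap is the supremum, over instances and matchings $M$ on which $\mathcal{LS}$ terminates, of the ratio of the maximum compatible matching size to $|M|$. -}

module Defs where

open import Data.Nat using (ℕ; zero; suc; _+_; _*_; _≤_; _<_; _≡ᵇ_)
open import Data.Fin using (Fin; toℕ)
open import Data.Bool using (Bool; true; false; not; _∧_; _∨_; T)
open import Data.Product using (Σ; ∃; ∃-syntax; _×_; _,_)
open import Data.Sum using (_⊎_)
open import Data.List using (List; length; filterᵇ; _++_)
open import Data.Bool.ListAction using (any)
open import Data.List.Membership.Propositional using (_∈_; _∉_)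
open import Data.List.Relation.Unary.All using (All)
open import Data.List.Relation.Unary.Any using (Any)
open import Data.List.Relation.Unary.AllPairs using (AllPairs)
open import Relation.Nullary using (¬_)
open import Relation.Binary.PropositionalEquality using (_≡_; _≢_)

-- Vertices d^A_1..d^A_N and d^B_1..d^B_N are indexed by Fin N (0-based).
-- The edge e_{i,j} is the pair (i , j).
Edge : ℕ → Set
Edge N = Fin N × Fin N

Graph : ℕ → Set
Graph N = Fin N → Fin N → Bool

InG : ∀ {N} → Graph N → Edge N → Set
InG G (i , j) = T (G i j)

NextRowBad : ∀ {N} → Edge N → Edge N → Set
NextRowBad (i , j) (i' , j') = toℕ i' ≡ suc (toℕ i) × toℕ j' ≢ suc (toℕ j)

NextColBad : ∀ {N} → Edge N → Edge N → Set
NextColBad (i , j) (i' , j') = toℕ j' ≡ suc (toℕ j) × toℕ i' ≢ suc (toℕ i)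

-- Conflict between two (distinct) edges: conditions (i),(ii),(iii), for the unordered pair.
Conflict : ∀ {N} → Edge N → Edge N → Set
Conflict e@(i , j) f@(i' , j') =
  i ≡ i' ⊎ j ≡ j'
  ⊎ NextRowBad e f ⊎ NextRowBad f e
  ⊎ NextColBad e f ⊎ NextColBad f e

DistinctCompatible : ∀ {N} → Edge N → Edge N → Set
DistinctCompatible e f = e ≢ f × ¬ Conflict e f

-- A set of pairwise compatible edges (as a duplicate-free list).
PairwiseCompatible : ∀ {N} → List (Edge N) → Set
PairwiseCompatible L = AllPairs DistinctCompatible L

CompatibleMatching : ∀ {N} → Graph N → List (Edge N) → Set
CompatibleMatching G M = All (InG G) M × PairwiseCompatible M

Maximal : ∀ {N} → Graph N → List (Edge N) → Set
Maximal G M = ∀ e → InG G e → e ∉ M → ¬ All (λ m → ¬ Conflict e m) M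

eqᵇ : ∀ {N} → Edge N → Edge N → Bool
eqᵇ (i , j) (i' , j') = (toℕ i ≡ᵇ toℕ i') ∧ (toℕ j ≡ᵇ toℕ j')

parallelᵇ : ∀ {N} → Edge N → Edge N → Bool
parallelᵇ (i , j) (i' , j') =
  ((toℕ i' ≡ᵇ suc (toℕ i)) ∧ (toℕ j' ≡ᵇ suc (toℕ j)))
  ∨ ((toℕ i ≡ᵇ suc (toℕ i')) ∧ (toℕ j ≡ᵇ suc (toℕ j')))

singletons : ∀ {N} → List (Edge N) → List (Edge N)
singletons M = filterᵇ (λ e → not (any (parallelᵇ e) M)) M

minus : ∀ {N} → List (Edge N) → List (Edge N) → List (Edge N)
minus M X = filterᵇ (λ m → not (any (eqᵇ m) X)) M

InC : ∀ {N} → Graph N → List (Edge N) → List (Edge N) → Edge N → Set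
InC G M X e =
  InG G e
  × Any (λ x → x ≢ e × Conflict x e) X
  × (∀ m → m ∈ M → m ∉ X → DistinctCompatible e m)

FiveSubset : ∀ {N} → List (Edge N) → List (Edge N) → Set
FiveSubset M X = AllPairs _≢_ X × length X ≡ 5 × All (_∈ M) X

Candidate : ∀ {N} → Graph N → List (Edge N) → List (Edge N) → ℕ → List (Edge N) → Set
Candidate G M X k X' =
  PairwiseCompatible X' × length X' ≡ k
  × All (λ e → e ∈ X ⊎ InC G M X e) X'

Replace5by6Applicable : ∀ {N} → Graph N → List (Edge N) → Set
Replace5by6Applicable G M =
  Σ (List _) λ X → FiveSubset M X × Σ (List _) λ X' → Candidate G M X 6 X'

Reduce5by5Applicable : ∀ {N} → Graph N → List (Edge N) → Set
Reduce5by5Applicable G M =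
  Σ (List _) λ X → FiveSubset M X × Σ (List _) λ X' → Candidate G M X 5 X'
    × length (singletons (minus M X ++ X')) < length (singletons M)

-- For |M| ≤ 5: exhaustive-search versions of the moves.
SmallIncreaseApplicable : ∀ {N} → Graph N → List (Edge N) → Set
SmallIncreaseApplicable G M =
  Σ (List _) λ M' → CompatibleMatching G M' × length M' ≡ suc (length M)

SmallReduceApplicable : ∀ {N} → Graph N → List (Edge N) → Set
SmallReduceApplicable G M =
  Σ (List _) λ M' → CompatibleMatching G M' × length M' ≡ length M
    × length (singletons M') < length (singletons M)

LSTerminatesOn : ∀ {N} → Graph N → List (Edge N) → Set
LSTerminatesOn G M =
  Maximal G M
  × (5 < length M → ¬ Replace5by6Applicable G M × ¬ Reduce5by5Applicable G M)
  × (length M ≤ 5 → ¬ SmallIncreaseApplicable G M × ¬ SmallReduceApplicable G M)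

MaxCompatibleSize : ∀ {N} → Graph N → ℕ → Set
MaxCompatibleSize G k =
  (Σ (List _) λ M → CompatibleMatching G M × length M ≡ k)
  × (∀ M → CompatibleMatching G M → length M ≤ k)

-- Instance: N = 26, M consists of the 12 edges
--   e(1,12) e(3,10) e(5,14) e(7,0) e(9,16) e(11,20) e(13,24) e(15,22)
--   e(17,2) e(21,4) e(23,8) e(25,18),
-- and G is M together with the 26 diagonal edges e(i,i).  The diagonal edges
-- are pairwise parallel, hence a compatible matching of size 26, and no
-- compatible matching is larger since it uses every left vertex at most once
-- (compatible-length).  As 6 * 26 = 13 * 12 it remains to show that LS
-- started on M stops at once.
--
-- For the two moves (module LocalMoves),
-- an exchange of a 5-subset X of M for X' only uses edges of the "pool" of X:
-- edges of X and edges compatible with all of M outside X.  The pool only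
-- grows with X, so X may be replaced by its trace on M, one of the 5-subsets
-- of M.  Replace-5-by-6 then fails because no pool contains 6 pairwise
-- compatible edges.  For Reduce-5-by-5, no edge of M is parallel to an edge
-- of G, so a non-singleton of the new matching yields two parallel edges in
-- X'; this fails because no pool contains 5 pairwise compatible edges two of
-- which are parallel.
module Submission where

open import Defs
open import Data.Nat as ℕ using (ℕ; zero; suc; _+_; _*_; _≤_; _<_; z≤n; s≤s; z<s)
open import Data.Nat.Properties
  using (≡ᵇ⇒≡; ≤-antisym; ≤-reflexive; ≤-trans; <-≤-trans; <-irrefl; module ≤-Reasoning)
open import Data.Fin as Fin using (toℕ; #_)
open import Data.Fin.Properties using (toℕ-injective)
open import Data.Bool using (Bool; true; false; not; _∧_; _∨_; T)
open import Data.Bool.Properties using (T-∧; ∨-comm)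
open import Data.Bool.ListAction using (any)
open import Data.Product as Product using (Σ; ∃₂; _×_; _,_; proj₁; proj₂)
open import Data.Product.Properties using (≡-dec)
open import Data.Sum as Sum using (_⊎_; inj₁; inj₂)
open import Data.Unit using (tt)
open import Data.Empty using (⊥; ⊥-elim)
open import Data.List using (List; []; _∷_; [_]; length; filter; map; _++_; allFin)
open import Data.List.Properties
  using (length-++; length-map; length-filter; length-tabulate; filter-all; map-++; map-∘)
open import Data.List.Relation.Unary.All as All using (All; []; _∷_)
import Data.List.Relation.Unary.All.Properties as Allₚ
open Allₚ using (¬All⇒Any¬; All¬⇒¬Any)
open import Data.List.Relation.Unary.Any as Any using (Any; here; there)
open import Data.List.Relation.Unary.Any.Properties using (any⁻; ¬Any[])
open import Data.List.Relation.Unary.AllPairs as AllPairs using (AllPairs; []; _∷_; allPairs?)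
import Data.List.Relation.Unary.AllPairs.Properties as AllPairsₚ
open import Data.List.Relation.Unary.Unique.Propositional using (Unique)
open import Data.List.Membership.Propositional using (_∈_; _∉_; find)
open import Data.List.Membership.Propositional.Properties
  using (∈-++⁺ˡ; ∈-++⁺ʳ; ∈-++⁻; ∈-∃++; ∈-map⁺; ∈-map⁻; ∈-filter⁺; ∈-filter⁻; ∈-allFin)
open import Data.List.Relation.Binary.Subset.Propositional using (_⊆_)
open import Function using (_∘_; id)
open import Function.Bundles using (Equivalence; _⇔_; mk⇔)
open import Relation.Binary.Definitions using (Decidable; DecidableEquality; Symmetric)
import Relation.Unary as U
open import Relation.Nullary using (¬_; Dec; yes; no; does; ¬?; contradiction)
import Relation.Nullary.Decidable as Decidable
open Decidable using (_×-dec_; _⊎-dec_; T?; isYes; toWitness; from-yes; from-no)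
open import Relation.Binary.PropositionalEquality
  using (_≡_; _≢_; refl; sym; trans; cong; cong₂; subst; module ≡-Reasoning)


¬T-not : ∀ {b} → ¬ T (not b) → T b
¬T-not {true}  _     = tt
¬T-not {false} ¬T-tt = ¬T-tt tt


-- Vertex-number codes of edges.  All finite checks are evaluated on codes,
-- whose entries are numerals, rather than on elements of Fin N.
Code : Set
Code = ℕ × ℕ

_≟ᶜ_ : DecidableEquality Code
_≟ᶜ_ = ≡-dec ℕ._≟_ ℕ._≟_

CodeConflict : Code → Code → Set
CodeConflict (a , b) (c , d) =
  a ≡ c ⊎ b ≡ d
  ⊎ (c ≡ suc a × d ≢ suc b) ⊎ (a ≡ suc c × b ≢ suc d)
  ⊎ (d ≡ suc b × c ≢ suc a) ⊎ (b ≡ suc d × a ≢ suc c)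

codeConflict? : Decidable CodeConflict
codeConflict? (a , b) (c , d) =
  a ℕ.≟ c ⊎-dec b ℕ.≟ d
  ⊎-dec (c ℕ.≟ suc a ×-dec ¬? (d ℕ.≟ suc b)) ⊎-dec (a ℕ.≟ suc c ×-dec ¬? (b ℕ.≟ suc d))
  ⊎-dec (d ℕ.≟ suc b ×-dec ¬? (c ℕ.≟ suc a)) ⊎-dec (b ℕ.≟ suc d ×-dec ¬? (a ℕ.≟ suc c))

codeConflict-sym : Symmetric CodeConflict
codeConflict-sym (inj₁ a≡c)                           = inj₁ (sym a≡c)
codeConflict-sym (inj₂ (inj₁ b≡d))                    = inj₂ (inj₁ (sym b≡d))
codeConflict-sym (inj₂ (inj₂ (inj₁ xy)))              = inj₂ (inj₂ (inj₂ (inj₁ xy)))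
codeConflict-sym (inj₂ (inj₂ (inj₂ (inj₁ yx))))       = inj₂ (inj₂ (inj₁ yx))
codeConflict-sym (inj₂ (inj₂ (inj₂ (inj₂ (inj₁ xy))))) = inj₂ (inj₂ (inj₂ (inj₂ (inj₂ xy))))
codeConflict-sym (inj₂ (inj₂ (inj₂ (inj₂ (inj₂ yx))))) = inj₂ (inj₂ (inj₂ (inj₂ (inj₁ yx))))

CodeCompatible : Code → Code → Set
CodeCompatible x y = x ≢ y × ¬ CodeConflict x y

codeCompatible? : Decidable CodeCompatible
codeCompatible? x y = ¬? (x ≟ᶜ y) ×-dec ¬? (codeConflict? x y)

codeCompatible-sym : Symmetric CodeCompatible
codeCompatible-sym (x≢y , ¬conflict) = x≢y ∘ sym , ¬conflict ∘ codeConflict-sym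

codeCompatible-irrefl : ∀ {x} → ¬ CodeCompatible x x
codeCompatible-irrefl (x≢x , _) = x≢x refl

-- The parallelism test of Defs on codes: parallelᵇ e f unfolds to
-- parallelᶜ (code e) (code f).
parallelᶜ : Code → Code → Bool
parallelᶜ (a , b) (c , d) = ((c ℕ.≡ᵇ suc a) ∧ (d ℕ.≡ᵇ suc b)) ∨ ((a ℕ.≡ᵇ suc c) ∧ (b ℕ.≡ᵇ suc d))


module _ {N : ℕ} where

  code : Edge N → Code
  code (i , j) = toℕ i , toℕ j

  code-injective : ∀ {e f : Edge N} → code e ≡ code f → e ≡ f
  code-injective {i , j} {i' , j'} eq =
    cong₂ _,_ (toℕ-injective (cong proj₁ eq)) (toℕ-injective (cong proj₂ eq))

  -- Conflicts of edges are conflicts of their codes; only condition (i)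
  -- differs, comparing vertices instead of their numbers.
  conflict⇔ : ∀ {e f : Edge N} → Conflict e f ⇔ CodeConflict (code e) (code f)
  conflict⇔ = mk⇔ (Sum.map (cong toℕ) (Sum.map (cong toℕ) id))
                  (Sum.map toℕ-injective (Sum.map toℕ-injective id))

  compatible⇔ : ∀ {e f : Edge N} → DistinctCompatible e f ⇔ CodeCompatible (code e) (code f)
  compatible⇔ = mk⇔ (Product.map (_∘ code-injective) (_∘ Equivalence.from conflict⇔))
                    (Product.map (_∘ cong code) (_∘ Equivalence.to conflict⇔))

  _≟ᴱ_ : DecidableEquality (Edge N)
  _≟ᴱ_ = ≡-dec Fin._≟_ Fin._≟_

  conflict? : Decidable (Conflict {N})
  conflict? e f = Decidable.map′ (Equivalence.from conflict⇔) (Equivalence.to conflict⇔)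
                                 (codeConflict? (code e) (code f))

  compatible? : Decidable (DistinctCompatible {N})
  compatible? e f = Decidable.map′ (Equivalence.from compatible⇔) (Equivalence.to compatible⇔)
                                   (codeCompatible? (code e) (code f))

  eqᵇ-sound : ∀ {e f : Edge N} → T (eqᵇ e f) → e ≡ f
  eqᵇ-sound {i , j} {i' , j'} t =
    let (i≡i' , j≡j') = Equivalence.to T-∧ t
    in cong₂ _,_ (toℕ-injective (≡ᵇ⇒≡ _ _ i≡i')) (toℕ-injective (≡ᵇ⇒≡ _ _ j≡j'))

  parallel-sym : ∀ (e f : Edge N) → T (parallelᵇ e f) → T (parallelᵇ f e)
  parallel-sym (i , j) (i' , j') =
    subst T (∨-comm ((toℕ i' ℕ.≡ᵇ suc (toℕ i)) ∧ (toℕ j' ℕ.≡ᵇ suc (toℕ j)))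
                    ((toℕ i ℕ.≡ᵇ suc (toℕ i')) ∧ (toℕ j ℕ.≡ᵇ suc (toℕ j'))))

  inG? : (G : Graph N) → U.Decidable (InG G)
  inG? G (i , j) = T? (G i j)

  compatibleMatching? : (G : Graph N) → U.Decidable (CompatibleMatching G)
  compatibleMatching? G L = All.all? (inG? G) L ×-dec allPairs? compatible? L


module _ {A : Set} where

  length-insert : ∀ (l : List A) {x r} → length (l ++ x ∷ r) ≡ suc (length (l ++ r))
  length-insert []      = refl
  length-insert (_ ∷ l) = cong suc (length-insert l)

  unique-length : ∀ {xs ys : List A} → Unique xs → xs ⊆ ys → length xs ≤ length ys
  unique-length {[]}     _               _     = z≤n
  unique-length {x ∷ xs} (x∉xs ∷ uniq) xs⊆ys with l , r , refl ← ∈-∃++ (xs⊆ys (here refl)) =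
    subst (suc (length xs) ≤_) (sym (length-insert l)) (s≤s (unique-length uniq xs⊆l++r))
    where
    xs⊆l++r : xs ⊆ l ++ r
    xs⊆l++r y∈xs with ∈-++⁻ l (xs⊆ys (there y∈xs))
    ... | inj₁ y∈l         = ∈-++⁺ˡ y∈l
    ... | inj₂ (here refl) = contradiction refl (All.lookup x∉xs y∈xs)
    ... | inj₂ (there y∈r) = ∈-++⁺ʳ l y∈r

  ∈-insert-mid : ∀ (l : List A) {x : A} {r : List A} {y : A} →
                 y ∈ l ++ r → y ∈ l ++ x ∷ r
  ∈-insert-mid l y∈ with ∈-++⁻ l y∈
  ... | inj₁ y∈l = ∈-++⁺ˡ y∈l
  ... | inj₂ y∈r = ∈-++⁺ʳ l (there y∈r)

  allPairs-∈ : ∀ {R : A → A → Set} → Symmetric R →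
               ∀ {xs x y} → AllPairs R xs → x ∈ xs → y ∈ xs → x ≡ y ⊎ R x y
  allPairs-∈ R-sym (_ ∷ _)   (here refl) (here refl) = inj₁ refl
  allPairs-∈ R-sym (px ∷ _)  (here refl) (there y∈)  = inj₂ (All.lookup px y∈)
  allPairs-∈ R-sym (px ∷ _)  (there x∈)  (here refl) = inj₂ (R-sym (All.lookup px x∈))
  allPairs-∈ R-sym (_ ∷ pxs) (there x∈)  (there y∈)  = allPairs-∈ R-sym pxs x∈ y∈

  allPairs-remove : ∀ {R : A → A → Set} → Symmetric R → ∀ l {x r} →
                    AllPairs R (l ++ x ∷ r) → AllPairs R (l ++ r) × All (R x) (l ++ r)
  allPairs-remove R-sym []      (x~r ∷ pr) = pr , x~r
  allPairs-remove R-sym (y ∷ l) (y~ ∷ pr)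
    with pr′ , x~lr ← allPairs-remove R-sym l pr
       | y~l , (y~x ∷ y~r) ← Allₚ.++⁻ l y~ =
    Allₚ.++⁺ y~l y~r ∷ pr′ , R-sym y~x ∷ x~lr

  choose : ℕ → List A → List (List A)
  choose zero    _        = [ [] ]
  choose (suc k) []       = []
  choose (suc k) (x ∷ xs) = map (x ∷_) (choose k xs) ++ choose (suc k) xs

  choose-skip : ∀ k {x xs ys} → ys ∈ choose k xs → ys ∈ choose k (x ∷ xs)
  choose-skip zero            ys∈ = ys∈
  choose-skip (suc k) {x} {xs} ys∈ = ∈-++⁺ʳ (map (x ∷_) (choose k xs)) ys∈

  -- Filtering produces a sublist; this is how any subset of M is found
  -- among the enumerated ones.
  filter∈choose : ∀ {p} {P : U.Pred A p} (P? : U.Decidable P) xs →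
                  filter P? xs ∈ choose (length (filter P? xs)) xs
  filter∈choose P? []       = here refl
  filter∈choose P? (x ∷ xs) with does (P? x)
  ... | true  = ∈-++⁺ˡ (∈-map⁺ (x ∷_) (filter∈choose P? xs))
  ... | false = choose-skip (length (filter P? xs)) (filter∈choose P? xs)


choose-map : ∀ {A B : Set} (f : A → B) k (xs : List A) →
             map (map f) (choose k xs) ≡ choose k (map f xs)
choose-map f zero    xs       = refl
choose-map f (suc k) []       = refl
choose-map f (suc k) (x ∷ xs) = begin
  map (map f) (map (x ∷_) (choose k xs) ++ choose (suc k) xs)
    ≡⟨ map-++ (map f) (map (x ∷_) (choose k xs)) _ ⟩
  map (map f) (map (x ∷_) (choose k xs)) ++ map (map f) (choose (suc k) xs)
    ≡⟨ cong₂ _++_ (trans (sym (map-∘ (choose k xs))) (map-∘ (choose k xs)))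
                  (choose-map f (suc k) xs) ⟩
  map (f x ∷_) (map (map f) (choose k xs)) ++ choose (suc k) (map f xs)
    ≡⟨ cong (λ ys → map (f x ∷_) ys ++ choose (suc k) (map f xs)) (choose-map f k xs) ⟩
  map (f x ∷_) (choose k (map f xs)) ++ choose (suc k) (map f xs)
    ∎
  where open ≡-Reasoning


module CliqueSearch {A : Set} {R : A → A → Set} (R? : Decidable R)
                    (R-sym : Symmetric R) (R-irrefl : ∀ {x} → ¬ R x x)
                    (_≟_ : DecidableEquality A) where

  open import Data.List.Membership.DecPropositional _≟_ using (_∈?_)

  -- hasNoClique k C: C contains no k pairwise R-related elements.
  -- A clique either avoids the head c, or consists of c and R-neighbours of c.
  hasNoClique : ℕ → List A → Bool
  hasNoClique zero    _       = false
  hasNoClique (suc k) []      = true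
  hasNoClique (suc k) (c ∷ C) = hasNoClique k (filter (R? c) C) ∧ hasNoClique (suc k) C

  clique-avoiding : ∀ {c : A} {C X : List A} → c ∉ X → X ⊆ c ∷ C → X ⊆ C
  clique-avoiding c∉X X⊆cC x∈X with X⊆cC x∈X
  ... | here refl = contradiction x∈X c∉X
  ... | there x∈C = x∈C

  clique-through : ∀ {c : A} {C X : List A} → c ∈ X → AllPairs R X → X ⊆ c ∷ C →
                   Σ (List A) λ X′ → AllPairs R X′ × X′ ⊆ filter (R? c) C
                                     × length X ≡ suc (length X′)
  clique-through {c} {C} c∈X clique X⊆cC
    with l , r , refl ← ∈-∃++ c∈X
    with clique′ , c~rest ← allPairs-remove R-sym l clique =
    l ++ r , clique′ , rest⊆nbrs , length-insert l
    where
    rest⊆nbrs : l ++ r ⊆ filter (R? c) C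
    rest⊆nbrs y∈ with X⊆cC (∈-insert-mid l y∈)
    ... | here refl = ⊥-elim (R-irrefl (All.lookup c~rest y∈))
    ... | there y∈C = ∈-filter⁺ (R? c) y∈C (All.lookup c~rest y∈)

  hasNoClique-sound : ∀ k C → T (hasNoClique k C) →
                      ∀ {X} → AllPairs R X → X ⊆ C → k ≤ length X → ⊥

  hasNoClique-sound-∷ : ∀ k c C → T (hasNoClique k (c ∷ C)) →
                        ∀ {X} → AllPairs R X → X ⊆ c ∷ C → k ≤ length X → Dec (c ∈ X) → ⊥

  hasNoClique-sound zero    _       ()
  hasNoClique-sound (suc k) []      _        {[]}    _      _    ()
  hasNoClique-sound (suc k) []      _        {_ ∷ _} _      X⊆[] _ = ¬Any[] (X⊆[] (here refl))
  hasNoClique-sound k       (c ∷ C) noClique {X} clique X⊆cC k≤|X| =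
    hasNoClique-sound-∷ k c C noClique clique X⊆cC k≤|X| (c ∈? X)

  hasNoClique-sound-∷ zero    _ _ ()
  hasNoClique-sound-∷ (suc k) c C noClique clique X⊆cC k<|X| (no c∉X) =
    hasNoClique-sound (suc k) C (proj₂ (Equivalence.to T-∧ noClique))
      clique (clique-avoiding c∉X X⊆cC) k<|X|
  hasNoClique-sound-∷ (suc k) c C noClique clique X⊆cC k<|X| (yes c∈X) =
    let (X′ , clique′ , X′⊆nbrs , |X|≡) = clique-through c∈X clique X⊆cC
    in hasNoClique-sound k (filter (R? c) C) (proj₁ (Equivalence.to T-∧ noClique))
         clique′ X′⊆nbrs (ℕ.≤-pred (subst (suc k ≤_) |X|≡ k<|X|))

  commonNeighbours : A → A → List A → List A
  commonNeighbours a b = filter (λ x → R? a x ×-dec R? b x)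

  -- A clique containing a and b consists of a, b and common neighbours;
  -- used for cliques through a parallel pair.
  clique-around : ∀ {X C a b} → AllPairs R X → X ⊆ C → a ∈ X → b ∈ X →
                  X ⊆ a ∷ b ∷ commonNeighbours a b C
  clique-around clique X⊆C a∈X b∈X x∈X
    with allPairs-∈ R-sym clique a∈X x∈X | allPairs-∈ R-sym clique b∈X x∈X
  ... | inj₁ refl | _         = here refl
  ... | inj₂ _    | inj₁ refl = there (here refl)
  ... | inj₂ a~x  | inj₂ b~x  = there (there (∈-filter⁺ _ (X⊆C x∈X) (a~x , b~x)))


module _ {N : ℕ} where

  -- A compatible matching uses each left vertex at most once, hence has at most N edges.
  compatible-length : ∀ (G : Graph N) {L} → CompatibleMatching G L → length L ≤ N
  compatible-length G {L} (_ , pairwise) = begin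
    length L              ≡⟨ sym (length-map proj₁ L) ⟩
    length (map proj₁ L)  ≤⟨ unique-length distinctLeft (λ {i} _ → ∈-allFin i) ⟩
    length (allFin N)     ≡⟨ length-tabulate (λ i → i) ⟩
    N                     ∎
    where
    open ≤-Reasoning
    distinctLeft : Unique (map proj₁ L)
    distinctLeft = AllPairsₚ.map⁺ (AllPairs.map (λ (_ , ¬conflict) → ¬conflict ∘ inj₁) pairwise)

  non-singleton : ∀ (L : List (Edge N)) → length (singletons L) < length L →
                  ∃₂ λ e f → e ∈ L × f ∈ L × T (parallelᵇ e f)
  non-singleton L fewer =
    let (e , e∈L , e-not-singleton) = find (¬All⇒Any¬ (T? ∘ isSingleton) L allSingletons)
        (f , f∈L , e∥f) = find (any⁻ (parallelᵇ e) L (¬T-not e-not-singleton))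
    in e , f , e∈L , f∈L , e∥f
    where
    isSingleton : Edge N → Bool
    isSingleton e = not (any (parallelᵇ e) L)

    allSingletons : ¬ All (T ∘ isSingleton) L
    allSingletons all = <-irrefl (cong length (filter-all (T? ∘ isSingleton) all)) fewer

  maximal-from : ∀ (G : Graph N) {E M} → (∀ {e} → InG G e → e ∈ E) →
                 All (λ e → e ∈ M ⊎ Any (Conflict e) M) E → Maximal G M
  maximal-from G G⊆E covered e e∈G e∉M compatibleWithM with All.lookup covered (G⊆E e∈G)
  ... | inj₁ e∈M     = e∉M e∈M
  ... | inj₂ conflict = All¬⇒¬Any compatibleWithM conflict


-- E is a list containing all edges of G; the checks are evaluated on
-- the code lists Eᶜ and Mᶜ, supplied with their defining equations.
module LocalMoves {N : ℕ} (G : Graph N) (E : List (Edge N)) (G⊆E : ∀ {e} → InG G e → e ∈ E)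
                  (M : List (Edge N)) (M⊆E : M ⊆ E) (uniqueM : Unique M)
                  (Eᶜ Mᶜ : List Code) (Eᶜ≡ : map code E ≡ Eᶜ) (Mᶜ≡ : map code M ≡ Mᶜ) where

  open import Data.List.Membership.DecPropositional (_≟ᴱ_ {N}) using (_∈?_)
  open import Data.List.Membership.DecPropositional _≟ᶜ_ using () renaming (_∈?_ to _∈ᶜ?_)
  open CliqueSearch codeCompatible? codeCompatible-sym codeCompatible-irrefl _≟ᶜ_ public

  Enters : List Code → Code → Set
  Enters Yᶜ x = x ∈ Yᶜ ⊎ All (λ m → m ∈ Yᶜ ⊎ CodeCompatible x m) Mᶜ

  enters? : ∀ Yᶜ → U.Decidable (Enters Yᶜ)
  enters? Yᶜ x = x ∈ᶜ? Yᶜ ⊎-dec All.all? (λ m → m ∈ᶜ? Yᶜ ⊎-dec codeCompatible? x m) Mᶜ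

  pool : List Code → List Code
  pool Yᶜ = filter (enters? Yᶜ) Eᶜ

  Offered : List (Edge N) → List (Edge N) → Set
  Offered X X' = All (λ e → e ∈ X ⊎ InC G M X e) X'

  offered⊆E : ∀ {X X'} → X ⊆ M → Offered X X' → X' ⊆ E
  offered⊆E X⊆M offered e∈X' with All.lookup offered e∈X'
  ... | inj₁ e∈X        = M⊆E (X⊆M e∈X)
  ... | inj₂ (e∈G , _) = G⊆E e∈G

  offered⊆pool : ∀ {X Y X'} → X ⊆ M → X ⊆ Y → Offered X X' → map code X' ⊆ pool (map code Y)
  offered⊆pool {X} {Y} X⊆M X⊆Y offered x∈X'ᶜ
    with e , e∈X' , refl ← ∈-map⁻ code x∈X'ᶜ =
    ∈-filter⁺ (enters? (map code Y)) e∈E (enters (All.lookup offered e∈X'))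
    where
    e∈E : code e ∈ Eᶜ
    e∈E = subst (code e ∈_) Eᶜ≡ (∈-map⁺ code (offered⊆E X⊆M offered e∈X'))

    enters : e ∈ X ⊎ InC G M X e → Enters (map code Y) (code e)
    enters (inj₁ e∈X) = inj₁ (∈-map⁺ code (X⊆Y e∈X))
    enters (inj₂ (_ , _ , compatibleOutsideX)) = inj₂ (All.tabulate outsideY)
      where
      outsideY : ∀ {mᶜ} → mᶜ ∈ Mᶜ → mᶜ ∈ map code Y ⊎ CodeCompatible (code e) mᶜ
      outsideY mᶜ∈Mᶜ with m , m∈M , refl ← ∈-map⁻ code (subst (_ ∈_) (sym Mᶜ≡) mᶜ∈Mᶜ)
                     with m ∈? Y
      ... | yes m∈Y = inj₁ (∈-map⁺ code m∈Y)
      ... | no  m∉Y = inj₂ (Equivalence.to compatible⇔ (compatibleOutsideX m m∈M (m∉Y ∘ X⊆Y)))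

  codes-compatible : ∀ {X' : List (Edge N)} → PairwiseCompatible X' →
                     AllPairs CodeCompatible (map code X')
  codes-compatible = AllPairsₚ.map⁺ ∘ AllPairs.map (Equivalence.to compatible⇔)

  trace : List (Edge N) → List (Edge N)
  trace X = filter (_∈? X) M

  X⊆trace : ∀ {X} → All (_∈ M) X → X ⊆ trace X
  X⊆trace {X} X⊆M x∈X = ∈-filter⁺ (_∈? X) (All.lookup X⊆M x∈X) x∈X

  trace-choose : ∀ {X} → FiveSubset M X → map code (trace X) ∈ choose 5 Mᶜ
  trace-choose {X} (uniqueX , |X|≡5 , X⊆M) =
    subst (map code (trace X) ∈_) (trans (choose-map code 5 M) (cong (choose 5) Mᶜ≡))
      (∈-map⁺ (map code) (subst (λ k → trace X ∈ choose k M) |trace|≡5 (filter∈choose (_∈? X) M)))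
    where
    |trace|≡5 : length (trace X) ≡ 5
    |trace|≡5 = trans (≤-antisym
      (unique-length (AllPairsₚ.filter⁺ (_∈? X) uniqueM)
                     (λ x∈trace → proj₂ (∈-filter⁻ (_∈? X) {xs = M} x∈trace)))
      (unique-length uniqueX (X⊆trace X⊆M))) |X|≡5

  no-replace : (∀ {Yᶜ} → Yᶜ ∈ choose 5 Mᶜ → T (hasNoClique 6 (pool Yᶜ))) →
               ¬ Replace5by6Applicable G M
  no-replace noSixClique (X , five@(_ , _ , X⊆M) , X' , (pairwise , |X'|≡6 , offered)) =
    hasNoClique-sound 6 (pool (map code (trace X))) (noSixClique (trace-choose five))
      (codes-compatible pairwise) (offered⊆pool (All.lookup X⊆M) (X⊆trace X⊆M) offered)
      (≤-reflexive (sym (trans (length-map code X') |X'|≡6)))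

  minus⊆M : ∀ X → minus M X ⊆ M
  minus⊆M X = proj₁ ∘ ∈-filter⁻ (T? ∘ λ m → not (any (eqᵇ m) X))

  minus-cover : ∀ X → M ⊆ minus M X ++ X
  minus-cover X {m} m∈M with T? (not (any (eqᵇ m) X))
  ... | yes kept    = ∈-++⁺ˡ (∈-filter⁺ (T? ∘ λ m → not (any (eqᵇ m) X)) m∈M kept)
  ... | no  removed = ∈-++⁺ʳ (minus M X) (Any.map eqᵇ-sound (any⁻ (eqᵇ m) X (¬T-not removed)))

  exchange-length : ∀ {X X'} → length X ≡ length X' → length M ≤ length (minus M X ++ X')
  exchange-length {X} {X'} |X|≡|X'| = begin
    length M                         ≤⟨ unique-length uniqueM (minus-cover X) ⟩
    length (minus M X ++ X)          ≡⟨ length-++ (minus M X) ⟩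
    length (minus M X) + length X    ≡⟨ cong (length (minus M X) +_) |X|≡|X'| ⟩
    length (minus M X) + length X'   ≡⟨ sym (length-++ (minus M X)) ⟩
    length (minus M X ++ X')         ∎
    where open ≤-Reasoning

  parallel-pair-in-X' : (∀ {m e} → m ∈ M → e ∈ E → ¬ T (parallelᵇ m e)) →
                        ∀ {X X' e f} → X' ⊆ E →
                        e ∈ minus M X ++ X' → f ∈ minus M X ++ X' → T (parallelᵇ e f) →
                        e ∈ X' × f ∈ X'
  parallel-pair-in-X' noParallelToM {X} {X'} {e} {f} X'⊆E e∈L f∈L e∥f
    with ∈-++⁻ (minus M X) e∈L | ∈-++⁻ (minus M X) f∈L
  ... | inj₂ e∈X'   | inj₂ f∈X'   = e∈X' , f∈X'
  ... | inj₁ e∈M\X | _           = ⊥-elim (noParallelToM (minus⊆M X e∈M\X) (L⊆E f∈L) e∥f)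
    where
    L⊆E : minus M X ++ X' ⊆ E
    L⊆E u∈L with ∈-++⁻ (minus M X) u∈L
    ... | inj₁ u∈M\X = M⊆E (minus⊆M X u∈M\X)
    ... | inj₂ u∈X'   = X'⊆E u∈X'
  ... | inj₂ e∈X'   | inj₁ f∈M\X =
    ⊥-elim (noParallelToM (minus⊆M X f∈M\X) (X'⊆E e∈X') (parallel-sym e f e∥f))

  -- Reduce-5-by-5 fails if no edge of M is parallel to an edge of G and no
  -- pool has 5 pairwise compatible edges two of which are parallel: the new
  -- matching would be at least as long as M = s(M), hence has a parallel pair.
  no-reduce : (∀ {m e} → m ∈ M → e ∈ E → ¬ T (parallelᵇ m e)) →
              (∀ {Yᶜ} → Yᶜ ∈ choose 5 Mᶜ → ∀ {a b} → a ∈ pool Yᶜ → b ∈ pool Yᶜ →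
                 T (parallelᶜ a b) → T (hasNoClique 5 (a ∷ b ∷ commonNeighbours a b (pool Yᶜ)))) →
              ¬ Reduce5by5Applicable G M
  no-reduce noParallelToM noFiveClique
    (X , five@(_ , |X|≡5 , X⊆M) , X' , (pairwise , |X'|≡5 , offered) , fewerSingletons) =
    let |sM|≤|L| = ≤-trans (length-filter _ M) (exchange-length {X} {X'} (trans |X|≡5 (sym |X'|≡5)))
        (e , f , e∈L , f∈L , e∥f) =
          non-singleton (minus M X ++ X') (<-≤-trans fewerSingletons |sM|≤|L|)
        (e∈X' , f∈X') =
          parallel-pair-in-X' noParallelToM {X} (offered⊆E (All.lookup X⊆M) offered) e∈L f∈L e∥f
        eᶜ∈X'ᶜ = ∈-map⁺ code e∈X'
        fᶜ∈X'ᶜ = ∈-map⁺ code f∈X'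
    in hasNoClique-sound 5 _
         (noFiveClique (trace-choose five) (X'⊆pool eᶜ∈X'ᶜ) (X'⊆pool fᶜ∈X'ᶜ) e∥f)
         (codes-compatible pairwise)
         (clique-around (codes-compatible pairwise) X'⊆pool eᶜ∈X'ᶜ fᶜ∈X'ᶜ)
         (≤-reflexive (sym (trans (length-map code X') |X'|≡5)))
    where
    X'⊆pool : map code X' ⊆ pool (map code (trace X))
    X'⊆pool = offered⊆pool (All.lookup X⊆M) (X⊆trace X⊆M) offered


module Example where

  open import Data.List.Membership.DecPropositional (_≟ᴱ_ {26}) using (_∈?_)

  matching : List (Edge 26)
  matching =
    (# 1 , # 12) ∷ (# 3 , # 10) ∷ (# 5 , # 14) ∷ (# 7 , # 0) ∷ (# 9 , # 16) ∷ (# 11 , # 20) ∷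
    (# 13 , # 24) ∷ (# 15 , # 22) ∷ (# 17 , # 2) ∷ (# 21 , # 4) ∷ (# 23 , # 8) ∷ (# 25 , # 18) ∷ []

  diagonal : List (Edge 26)
  diagonal = map (λ i → i , i) (allFin 26)

  edges : List (Edge 26)
  edges = matching ++ diagonal

  graph : Graph 26
  graph i j = isYes ((i , j) ∈? edges)

  graph⊆edges : ∀ {e} → InG graph e → e ∈ edges
  graph⊆edges {i , j} = toWitness

  -- The codes of matching and edges, written as numerals for fast evaluation.
  matchingᶜ : List Code
  matchingᶜ =
    (1 , 12) ∷ (3 , 10) ∷ (5 , 14) ∷ (7 , 0) ∷ (9 , 16) ∷ (11 , 20) ∷
    (13 , 24) ∷ (15 , 22) ∷ (17 , 2) ∷ (21 , 4) ∷ (23 , 8) ∷ (25 , 18) ∷ []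

  edgesᶜ : List Code
  edgesᶜ = matchingᶜ ++
    (0 , 0) ∷ (1 , 1) ∷ (2 , 2) ∷ (3 , 3) ∷ (4 , 4) ∷ (5 , 5) ∷ (6 , 6) ∷ (7 , 7) ∷ (8 , 8) ∷
    (9 , 9) ∷ (10 , 10) ∷ (11 , 11) ∷ (12 , 12) ∷ (13 , 13) ∷ (14 , 14) ∷ (15 , 15) ∷ (16 , 16) ∷
    (17 , 17) ∷ (18 , 18) ∷ (19 , 19) ∷ (20 , 20) ∷ (21 , 21) ∷ (22 , 22) ∷ (23 , 23) ∷ (24 , 24) ∷
    (25 , 25) ∷ []

  matching-compatible : CompatibleMatching graph matching
  matching-compatible = from-yes (compatibleMatching? graph matching)

  diagonal-compatible : CompatibleMatching graph diagonal
  diagonal-compatible = from-yes (compatibleMatching? graph diagonal)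

  matching-maximal : Maximal graph matching
  matching-maximal = maximal-from graph graph⊆edges
    (from-yes (All.all? (λ e → e ∈? matching ⊎-dec Any.any? (conflict? e) matching) edges))

  matching-isolated : All (λ m → All (λ e → ¬ T (parallelᵇ m e)) edges) matching
  matching-isolated =
    from-yes (All.all? (λ m → All.all? (λ e → ¬? (T? (parallelᵇ m e))) edges) matching)

  open LocalMoves graph edges graph⊆edges matching ∈-++⁺ˡ
                  (AllPairs.map proj₁ (proj₂ matching-compatible)) edgesᶜ matchingᶜ refl refl

  Stable : List Code → Set
  Stable P = T (hasNoClique 6 P)
           × All (λ a → All (λ b → ¬ T (parallelᶜ a b)
                                  ⊎ T (hasNoClique 5 (a ∷ b ∷ commonNeighbours a b P))) P) P

  stable? : U.Decidable Stable
  stable? P = T? (hasNoClique 6 P)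
    ×-dec All.all? (λ a → All.all? (λ b → ¬? (T? (parallelᶜ a b))
                                         ⊎-dec T? (hasNoClique 5 (a ∷ b ∷ commonNeighbours a b P))) P) P

  all-pools-stable : All (Stable ∘ pool) (choose 5 matchingᶜ)
  all-pools-stable = from-yes (All.all? (stable? ∘ pool) (choose 5 matchingᶜ))

  matching-large : ¬ length matching ≤ 5
  matching-large = from-no (length matching ℕ.≤? 5)

  terminates : LSTerminatesOn graph matching
  terminates = matching-maximal , (λ _ → no-replace noSix , no-reduce noParallel noFive)
             , (λ small → contradiction small matching-large)
    where
    noSix : ∀ {Yᶜ} → Yᶜ ∈ choose 5 matchingᶜ → T (hasNoClique 6 (pool Yᶜ))
    noSix Y∈ = proj₁ (All.lookup all-pools-stable Y∈)
    noParallel : ∀ {m e} → m ∈ matching → e ∈ edges → ¬ T (parallelᵇ m e)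
    noParallel m∈ e∈ = All.lookup (All.lookup matching-isolated m∈) e∈
    noFive : ∀ {Yᶜ} → Yᶜ ∈ choose 5 matchingᶜ → ∀ {a b} → a ∈ pool Yᶜ → b ∈ pool Yᶜ →
             T (parallelᶜ a b) → T (hasNoClique 5 (a ∷ b ∷ commonNeighbours a b (pool Yᶜ)))
    noFive Y∈ a∈ b∈ a∥b = Sum.[ contradiction a∥b , id ]′
      (All.lookup (All.lookup (proj₂ (All.lookup all-pools-stable Y∈)) a∈) b∈)

  maximum : MaxCompatibleSize graph 26
  maximum = (diagonal , diagonal-compatible , refl) , λ _ → compatible-length graph


theorem5p2 : Σ ℕ λ N → Σ (Graph N) λ G → Σ (List (Edge N)) λ M →
    CompatibleMatching G M × 0 < length M × LSTerminatesOn G M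
    × Σ ℕ λ k → MaxCompatibleSize G k × 6 * k ≡ 13 * length M
-- M has 12 edges, LS stops on M, and the maximum is 26 = (13/6) * 12.
theorem5p2 = 26 , graph , matching , matching-compatible , z<s , terminates , 26 , maximum , refl
  where open Example
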